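{- Let $n \geq 1$. Write elements of $M_n(\mathbb{Z}_2[i])$ as $\mathcal{L} = L + iK$ with $L, K$ Boolean ($\{0,1\}$-valued) $n \times n$ matrices, and let $\widetilde{\mathbb{M}}^n = \{ L + iK \in M_n(\mathbb{Z}_2[i]) : LK = \mathbf{0}\}$. Let $\mathcal{S}_0 = L_0 + i K_0 \in \widetilde{\mathbb{M}}^n$, let $\sigma$ be an $n\times n$ permutation matrix, and let $\omega = \alpha + i(\alpha + \mathbf{1})$ be a swap, where $\alpha$ is any Boolean $n \times n$ matrix. Put $\sigma.\omega = \sigma \cdot \alpha \cdot \sigma^t + i\, \sigma \cdot (\alpha+\mathbf{1}) \cdot \sigma^t = L_2 + iK_2$. Then the scalar product $\langle \mathcal{S}_0, \sigma.\omega\rangle$ is defined, i.e. $(L_0 + K_0)(\mathbf{1} + L_2 + K_2) = \mathbf{0}$, and $\mathcal{S}_1 = \langle \mathcal{S}_0, \sigma.\omega \rangle \in \widetilde{\mathbb{M}}^n$. That is, the formal grammar whose production rules are $\mathcal{S}_1 = p(\mathcal{S}_0) = \langle \mathcal{S}_0, \sigma\cdot\omega\cdot\sigma^t\rangle$ is closed under these production rules.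
   Context: $\mathbb{Z}_2[i] = \{x + iy : x, y \in \{0,1\}\}$ with arithmetic mod 2. All matrix sums are entrywise mod 2; for Boolean matrices $X, Y$, $XY$ denotes the entrywise product $(x^j_m y^j_m)$; $\mathbf{0}$ is the all-zeros matrix and $\mathbf{1}$ the all-ones $n\times n$ matrix. The pointwise product on $M_n(\mathbb{Z}_2[i])$ is $(L + iK)(R + iQ) = (LR + KQ) + i(LQ + KR)$. The scalar product of $\mathcal{L}_1 = L_1 + iK_1$ and $\mathcal{L}_2 = L_2 + iK_2$ is $\langle \mathcal{L}_1, \mathcal{L}_2\rangle = (L_1 + iK_1)\big((\mathbf{1} + K_2) + i(\mathbf{1} + L_2)\big)$ (pointwise product), and it is declared defined when $(L_1 + K_1)(\mathbf{1} + L_2 + K_2) = \mathbf{0}$. The product $\sigma \cdot X \cdot \sigma^t$ is the ordinary matrix product over $\mathbb{Z}_2$ and acts as a relabeling of indices; it is applied to real and imaginary parts separately. (In the paper, elements additionally carry a node-labeling map on diagonal entries, which is merely permuted by $\sigma$ and plays no role in the claim.) -}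

module Defs where

open import Data.Nat using (ℕ)
open import Data.Fin using (Fin)
open import Data.Bool using (Bool; true; false; _∧_; _xor_)
open import Data.Product using (_×_; ∃-syntax)
open import Relation.Binary.PropositionalEquality using (_≡_)

-- Boolean n×n matrices = matrices over Z₂ (true = 1, false = 0)
BMat : ℕ → Set
BMat n = Fin n → Fin n → Bool

_⊕_ : ∀ {n} → BMat n → BMat n → BMat n
(X ⊕ Y) j m = X j m xor Y j m
infixl 6 _⊕_

-- entrywise (Hadamard) product  XY = (x^j_m y^j_m)
_⊙_ : ∀ {n} → BMat n → BMat n → BMat n
(X ⊙ Y) j m = X j m ∧ Y j m
infixl 7 _⊙_

𝟎 : ∀ {n} → BMat n
𝟎 _ _ = false

𝟏 : ∀ {n} → BMat n
𝟏 _ _ = true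

Σ₂ : ∀ {n} → (Fin n → Bool) → Bool
Σ₂ {ℕ.zero}  f = false
Σ₂ {ℕ.suc n} f = f Fin.zero xor Σ₂ (λ k → f (Fin.suc k))

_·_ : ∀ {n} → BMat n → BMat n → BMat n
(A · B) j m = Σ₂ (λ k → A j k ∧ B k m)
infixl 8 _·_

_ᵗ : ∀ {n} → BMat n → BMat n
(A ᵗ) j m = A m j

IsPermutationMatrix : ∀ {n} → BMat n → Set
IsPermutationMatrix {n} P =
  ((j : Fin n) → ∃[ m ] (P j m ≡ true × ((m' : Fin n) → P j m' ≡ true → m' ≡ m))) ×
  ((m : Fin n) → ∃[ j ] (P j m ≡ true × ((j' : Fin n) → P j' m ≡ true → j' ≡ j)))

record ZMat (n : ℕ) : Set where
  constructor _+i_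
  field
    re : BMat n
    im : BMat n
open ZMat public

_⊗_ : ∀ {n} → ZMat n → ZMat n → ZMat n
(L +i K) ⊗ (R +i Q) = (L ⊙ R ⊕ K ⊙ Q) +i (L ⊙ Q ⊕ K ⊙ R)

_≐_ : ∀ {n} → BMat n → BMat n → Set
_≐_ {n} X Y = (j m : Fin n) → X j m ≡ Y j m
infix 4 _≐_

InMtilde : ∀ {n} → ZMat n → Set
InMtilde (L +i K) = L ⊙ K ≐ 𝟎

ScalarDefined : ∀ {n} → ZMat n → ZMat n → Set
ScalarDefined (L₁ +i K₁) (L₂ +i K₂) = (L₁ ⊕ K₁) ⊙ (𝟏 ⊕ L₂ ⊕ K₂) ≐ 𝟎

⟨_,_⟩ : ∀ {n} → ZMat n → ZMat n → ZMat n
⟨ S , (L₂ +i K₂) ⟩ = S ⊗ ((𝟏 ⊕ K₂) +i (𝟏 ⊕ L₂))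

swap : ∀ {n} → BMat n → ZMat n
swap α = α +i (α ⊕ 𝟏)

act : ∀ {n} → BMat n → ZMat n → ZMat n
act σ (L +i K) = (σ · L · (σ ᵗ)) +i (σ · K · (σ ᵗ))

-- Conjugation by a permutation matrix is linear over Z₂ and fixes 𝟏, so σ.ω is again a
-- swap β + i(β + 𝟏).  Against a swap, 𝟏 + L₂ + K₂ = 𝟎, so every scalar product is defined,
-- and ⟨L + iK, ω⟩ = (Lβ + K(β + 𝟏)) + i(L(β + 𝟏) + Kβ); when LK = 𝟎 each entry has at most
-- one of L, K set, and then the real and imaginary parts are complementary there.
module Submission where

open import Defs
open import Data.Nat using (ℕ; zero; suc; _≥_)
open import Data.Fin using (Fin)
open import Data.Fin.Properties using (0≢1+n; suc-injective)
open import Data.Bool using (Bool; true; false; _∧_; _xor_)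
open import Data.Bool.Properties using (∧-zeroʳ; ∧-identityʳ; ∧-distribˡ-xor; ∧-distribʳ-xor; ¬-not; xor-∧-commutativeRing)
open import Data.Product using (_×_; _,_; proj₁; ∃-syntax)
open import Algebra.Bundles using (CommutativeRing)
open import Algebra.Properties.CommutativeSemigroup (CommutativeRing.+-commutativeSemigroup xor-∧-commutativeRing)
  using () renaming (interchange to xor-interchange)
open import Relation.Binary.PropositionalEquality using (_≡_; _≢_; refl; sym; trans; cong; cong₂; module ≡-Reasoning)

UniqueTrue : ∀ {n} → (Fin n → Bool) → Set
UniqueTrue {n} f = ∃[ m ] (f m ≡ true × ((m' : Fin n) → f m' ≡ true → m' ≡ m))

Σ₂-cong : ∀ {n} {f g : Fin n → Bool} → (∀ k → f k ≡ g k) → Σ₂ f ≡ Σ₂ g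
Σ₂-cong {zero}  f≡g = refl
Σ₂-cong {suc n} f≡g = cong₂ _xor_ (f≡g Fin.zero) (Σ₂-cong (λ k → f≡g (Fin.suc k)))

Σ₂-xor : ∀ {n} (f g : Fin n → Bool) → Σ₂ (λ k → f k xor g k) ≡ Σ₂ f xor Σ₂ g
Σ₂-xor {zero}  f g = refl
Σ₂-xor {suc n} f g =
  trans (cong ((f Fin.zero xor g Fin.zero) xor_) (Σ₂-xor (λ k → f (Fin.suc k)) (λ k → g (Fin.suc k))))
        (xor-interchange (f Fin.zero) (g Fin.zero) _ _)

Σ₂-false : ∀ {n} {f : Fin n → Bool} → (∀ k → f k ≢ true) → Σ₂ f ≡ false
Σ₂-false {zero}  f≢true = refl
Σ₂-false {suc n} f≢true = cong₂ _xor_ (¬-not (f≢true Fin.zero)) (Σ₂-false (λ k → f≢true (Fin.suc k)))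

Σ₂-uniqueTrue : ∀ {n} {f : Fin n → Bool} → UniqueTrue f → Σ₂ f ≡ true
Σ₂-uniqueTrue {suc n} (Fin.zero , f0 , unique) =
  cong₂ _xor_ f0 (Σ₂-false (λ k fk → 0≢1+n (sym (unique (Fin.suc k) fk))))
Σ₂-uniqueTrue {suc n} (Fin.suc m , fm , unique) =
  cong₂ _xor_ (¬-not (λ f0 → 0≢1+n (unique Fin.zero f0)))
              (Σ₂-uniqueTrue (m , fm , λ m' fm' → suc-injective (unique (Fin.suc m') fm')))

·-congʳ : ∀ {n} {X Y : BMat n} (B : BMat n) → X ≐ Y → X · B ≐ Y · B
·-congʳ B X≐Y j m = Σ₂-cong (λ k → cong (_∧ B k m) (X≐Y j k))

·-distribˡ-⊕ : ∀ {n} (A X Y : BMat n) → A · (X ⊕ Y) ≐ A · X ⊕ A · Y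
·-distribˡ-⊕ A X Y j m =
  trans (Σ₂-cong (λ k → ∧-distribˡ-xor (A j k) (X k m) (Y k m)))
        (Σ₂-xor (λ k → A j k ∧ X k m) (λ k → A j k ∧ Y k m))

·-distribʳ-⊕ : ∀ {n} (X Y B : BMat n) → (X ⊕ Y) · B ≐ X · B ⊕ Y · B
·-distribʳ-⊕ X Y B j m =
  trans (Σ₂-cong (λ k → ∧-distribʳ-xor (B k m) (X j k) (Y j k)))
        (Σ₂-xor (λ k → X j k ∧ B k m) (λ k → Y j k ∧ B k m))

RowsUniqueTrue : ∀ {n} → BMat n → Set
RowsUniqueTrue {n} σ = (j : Fin n) → UniqueTrue (σ j)

conj-𝟏 : ∀ {n} {σ : BMat n} → RowsUniqueTrue σ → σ · 𝟏 · σ ᵗ ≐ 𝟏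
conj-𝟏 {σ = σ} rows j m =
  trans (·-congʳ (σ ᵗ) σ·𝟏≐𝟏 j m) (Σ₂-uniqueTrue (rows m))
  where
  σ·𝟏≐𝟏 : σ · 𝟏 ≐ 𝟏
  σ·𝟏≐𝟏 j k = trans (Σ₂-cong (λ l → ∧-identityʳ (σ j l))) (Σ₂-uniqueTrue (rows j))

conj-complement : ∀ {n} {σ : BMat n} → RowsUniqueTrue σ → (α : BMat n) →
  σ · (α ⊕ 𝟏) · σ ᵗ ≐ σ · α · σ ᵗ ⊕ 𝟏
conj-complement {σ = σ} rows α j m = begin
  (σ · (α ⊕ 𝟏) · σ ᵗ) j m                ≡⟨ ·-congʳ (σ ᵗ) (·-distribˡ-⊕ σ α 𝟏) j m ⟩
  ((σ · α ⊕ σ · 𝟏) · σ ᵗ) j m            ≡⟨ ·-distribʳ-⊕ (σ · α) (σ · 𝟏) (σ ᵗ) j m ⟩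
  (σ · α · σ ᵗ) j m xor (σ · 𝟏 · σ ᵗ) j m ≡⟨ cong ((σ · α · σ ᵗ) j m xor_) (conj-𝟏 rows j m) ⟩
  (σ · α · σ ᵗ ⊕ 𝟏) j m                  ∎
  where open ≡-Reasoning

IsSwap : ∀ {n} → ZMat n → Set
IsSwap ω = im ω ≐ re ω ⊕ 𝟏

swap-annihilates : ∀ a → (true xor a) xor (a xor true) ≡ false
swap-annihilates false = refl
swap-annihilates true  = refl

disjoint-times-swap : ∀ l k a → l ∧ k ≡ false →
  ((l ∧ (true xor (a xor true))) xor (k ∧ (true xor a))) ∧
  ((l ∧ (true xor a)) xor (k ∧ (true xor (a xor true)))) ≡ false
disjoint-times-swap false false a     _ = refl
disjoint-times-swap false true  false _ = refl
disjoint-times-swap false true  true  _ = refl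
disjoint-times-swap true  false false _ = refl
disjoint-times-swap true  false true  _ = refl
disjoint-times-swap true  true  a     ()

scalarDefined-swap : ∀ {n} (S ω : ZMat n) → IsSwap ω → ScalarDefined S ω
scalarDefined-swap (L +i K) (L₂ +i K₂) ω-swap j m =
  trans (cong (λ b → (L j m xor K j m) ∧ ((true xor L₂ j m) xor b)) (ω-swap j m))
        (trans (cong ((L j m xor K j m) ∧_) (swap-annihilates (L₂ j m))) (∧-zeroʳ _))

scalar-swap-InMtilde : ∀ {n} (S ω : ZMat n) → InMtilde S → IsSwap ω → InMtilde ⟨ S , ω ⟩
scalar-swap-InMtilde (L +i K) (L₂ +i K₂) S∈M̃ ω-swap j m =
  trans (cong (λ b → ((L j m ∧ (true xor b)) xor (K j m ∧ (true xor L₂ j m))) ∧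
                     ((L j m ∧ (true xor L₂ j m)) xor (K j m ∧ (true xor b))))
              (ω-swap j m))
        (disjoint-times-swap (L j m) (K j m) (L₂ j m) (S∈M̃ j m))

proposition2 : (n : ℕ) → n ≥ 1 → (S₀ : ZMat n) → InMtilde S₀ →
    (σ : BMat n) → IsPermutationMatrix σ → (α : BMat n) →
    ScalarDefined S₀ (act σ (swap α)) × InMtilde ⟨ S₀ , act σ (swap α) ⟩
proposition2 n _ S₀ S₀∈M̃ σ σ-perm α =
  scalarDefined-swap S₀ ω ω-swap , scalar-swap-InMtilde S₀ ω S₀∈M̃ ω-swap
  where
  ω : ZMat n
  ω = act σ (swap α)

  ω-swap : IsSwap ω
  ω-swap = conj-complement (proj₁ σ-perm) α
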